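{- Let $G$ be a cyclically $4$-edge-connected cubic graph and let $e$ be an edge of $G$ contained in some cyclic $4$-edge-cut of $G$. Then there exist vertex sets $A_1\subseteq A_2\subseteq\cdots\subseteq A_k$, with $B_i=V(G)\setminus A_i$ for $i=1,\dots,k$, such that every cyclic $4$-edge-cut of $G$ containing $e$ is of the form $E(A_i,B_i)$ for some $i$.
   Context: Graphs may have parallel edges. For a partition $\{A,B\}$ of $V(G)$, $E(A,B)$ is the set of edges between $A$ and $B$; it is a $k$-edge-cut if it has $k$ edges and cyclic if $G[A]$ and $G[B]$ both contain a cycle. A graph is cyclically $k$-edge-connected if it has no cyclic edge-cut with fewer than $k$ edges. -}

module Defs where

open import Data.Nat using (ℕ; zero; suc; _+_; _<_; _≤_)
open import Data.Fin using (Fin; zero; suc; toℕ)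
open import Data.Fin.Subset using (Subset; ∣_∣; _⊆_; _∈_; _∉_)
open import Data.Bool using (Bool; true; false; if_then_else_; _xor_)
open import Data.Vec using (Vec; tabulate; lookup)
open import Data.List using (map; allFin)
open import Data.Nat.ListAction using (sum)
open import Data.Product using (_×_; _,_; proj₁; proj₂; Σ; ∃)
open import Data.Fin using (_≟_)
open import Relation.Nullary using (does; ¬_)
open import Data.Sum using (_⊎_)
open import Data.Nat.DivMod using (_mod_)
open import Relation.Binary.PropositionalEquality using (_≡_)
open import Function.Definitions using (Injective)

-- A finite multigraph (parallel edges and loops allowed) with vertex set
-- Fin n and edge set Fin m; each edge has an (unordered) pair of endpoints.
record Multigraph : Set where
  field
    n : ℕ
    m : ℕ
    ends : Fin m → Fin n × Fin n
open Multigraph public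

-- number of endpoints of edge j equal to v (a loop counts twice)
incid : (G : Multigraph) → Fin (n G) → Fin (m G) → ℕ
incid G v j =
  (if does (proj₁ (ends G j) ≟ v) then 1 else 0) +
  (if does (proj₂ (ends G j) ≟ v) then 1 else 0)

degree : (G : Multigraph) → Fin (n G) → ℕ
degree G v = sum (map (incid G v) (allFin (m G)))

Cubic : Multigraph → Set
Cubic G = ∀ v → degree G v ≡ 3

next : ∀ {k} → Fin (suc k) → Fin (suc k)
next {k} i = (suc (toℕ i)) mod (suc k)

Joins : (G : Multigraph) → Fin (m G) → Fin (n G) → Fin (n G) → Set
Joins G j u v = ends G j ≡ (u , v) ⊎ ends G j ≡ (v , u)

-- A cycle of length k+1 in G: distinct vertices v_0..v_k and distinct edges
-- f_0..f_k with f_i joining v_i and v_{i+1 mod (k+1)}.  Length 1 = a loop,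
-- length 2 = a pair of parallel edges.
record Cycle (G : Multigraph) : Set where
  field
    len   : ℕ
    vtx   : Fin (suc len) → Fin (n G)
    edg   : Fin (suc len) → Fin (m G)
    vtx-inj : Injective _≡_ _≡_ vtx
    edg-inj : Injective _≡_ _≡_ edg
    joins : ∀ i → Joins G (edg i) (vtx i) (vtx (next i))
open Cycle public

HasCycleIn : (G : Multigraph) → (Fin (n G) → Set) → Set
HasCycleIn G P = Σ (Cycle G) λ C → ∀ i → P (vtx C i)

-- vertex sets as Subset (n G); B = complement of A.
-- E(A,B) as a subset of the edges: edges with exactly one endpoint in A.
cut : (G : Multigraph) → Subset (n G) → Subset (m G)
cut G A = tabulate λ j → lookup A (proj₁ (ends G j)) xor lookup A (proj₂ (ends G j))

CyclicCut : (G : Multigraph) → Subset (n G) → Set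
CyclicCut G A = HasCycleIn G (λ v → v ∈ A) × HasCycleIn G (λ v → v ∉ A)

CyclicallyEdgeConnected : ℕ → Multigraph → Set
CyclicallyEdgeConnected k G = ∀ (A : Subset (n G)) → CyclicCut G A → ¬ (∣ cut G A ∣ < k)

module Submission where

-- Seen from the side containing u, such a cut is a vertex set X with u ∈ X,
-- v ∉ X, d(X) = 4 and cycles on both sides.  Two counting facts drive the
-- proof: the handshake identity 3|X| = 2e(X) + d(X) for cubic graphs, and
-- the fact that a set with 1 ≤ |X| ≤ e(X) contains a cycle (dense⇒cyclic).
-- With cyclic 4-edge-connectivity they give: nonempty sets with cyclic
-- complement have d(X) ≥ min(4, |X| + 2), sides of 4-edge cuts have even
-- size, and the cycle conditions on a 4-edge cut can be replaced by the
-- decidable condition that both sides have at least three vertices (Thick).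
-- Counting the boundaries of the four corners of two crossing thick sets
-- forces two corners to be single vertices, which contradicts parity; so
-- thick sets are nested (Crossing).  Finally, A_t is taken to be the union of
-- the thick sets with at most t vertices: the A_t increase with t, and a
-- thick set with t vertices equals A_t.

open import Defs
open import Data.Nat using (ℕ; zero; suc; _+_; _*_; _≤_; _<_; z≤n; s≤s; _≤?_; _<?_)
open import Data.Nat.Properties hiding (_≟_)
open import Data.Nat.DivMod using (_%_; m<n⇒m%n≡m; n%n≡0)
open import Data.Nat.Divisibility using (_∣_; ∣m+n∣m⇒∣n; ∣1⇒≡1; m∣m*n)
open import Data.Nat.Tactic.RingSolver using (solve-∀)
import Data.Nat.ListAction as ListAction
open import Data.Bool using (Bool; true; false; not; _∧_; _∨_; _xor_; if_then_else_)
open import Data.Bool.Properties using (not-involutive; ∧-zeroʳ; ∧-identityʳ; ∧-comm)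
open import Data.Fin using (Fin; zero; suc; toℕ; fromℕ<; _≟_)
open import Data.Fin.Properties using (any?; pigeonhole; toℕ-injective; toℕ-fromℕ<; toℕ<n)
  renaming (suc-injective to fin-suc-injective)
open import Data.Fin.Subset using (Subset; ∣_∣; _⊆_; _∈_; _∉_; ∁)
open import Data.Fin.Subset.Properties using (anySubset?; ∣p∣≤n)
import Data.List as List
open import Data.Vec using ([]; _∷_; lookup; tabulate)
open import Data.Vec.Properties using (lookup∘tabulate; lookup-map; tabulate-cong; lookup⇒[]=; []=⇒lookup)
open import Data.Product using (Σ; _×_; _,_; proj₁; proj₂)
open import Data.Sum using (_⊎_; inj₁; inj₂)
open import Data.Empty using (⊥; ⊥-elim)
open import Function using (_∘_)
open import Relation.Nullary using (¬_; Dec; yes; no; does; contradiction)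
open import Relation.Nullary.Decidable using (_×-dec_; ¬?; dec-true; dec-false)
open import Relation.Binary.PropositionalEquality
open import Algebra.Properties.CommutativeMonoid.Sum +-0-commutativeMonoid
  using (sum; ∑-distrib-+; ∑-comm; sum-cong-≗; sum-replicate-zero)
open import Algebra.Properties.Semiring.Sum +-*-semiring using (*-distribˡ-sum)

𝟙 : Bool → ℕ
𝟙 true  = 1
𝟙 false = 0

𝟙-pos : ∀ {b} → 1 ≤ 𝟙 b → b ≡ true
𝟙-pos {true} _ = refl

𝟙*≤ : ∀ b t → 𝟙 b * t ≤ t
𝟙*≤ true  t = ≤-reflexive (+-identityʳ t)
𝟙*≤ false t = z≤n

∑-mono : ∀ {k} {f g : Fin k → ℕ} → (∀ i → f i ≤ g i) → sum f ≤ sum g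
∑-mono {zero}  f≤g = z≤n
∑-mono {suc k} f≤g = +-mono-≤ (f≤g zero) (∑-mono (f≤g ∘ suc))

∑-strict : ∀ {k} {f g : Fin k → ℕ} → (∀ i → f i ≤ g i) → ∀ i → f i < g i → sum f < sum g
∑-strict f≤g zero    lt = +-mono-<-≤ lt (∑-mono (f≤g ∘ suc))
∑-strict f≤g (suc i) lt = +-mono-≤-< (f≤g zero) (∑-strict (f≤g ∘ suc) i lt)

term≤∑ : ∀ {k} (f : Fin k → ℕ) i → f i ≤ sum f
term≤∑ f zero    = m≤m+n _ _
term≤∑ f (suc i) = ≤-trans (term≤∑ (f ∘ suc) i) (m≤n+m _ _)

two-terms≤∑ : ∀ {k} (f : Fin k → ℕ) i j → i ≢ j → f i + f j ≤ sum f
two-terms≤∑ f zero    zero    i≢j = contradiction refl i≢j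
two-terms≤∑ f zero    (suc j) i≢j = +-monoʳ-≤ (f zero) (term≤∑ (f ∘ suc) j)
two-terms≤∑ f (suc i) zero    i≢j =
  subst (_≤ sum f) (+-comm (f zero) (f (suc i))) (+-monoʳ-≤ (f zero) (term≤∑ (f ∘ suc) i))
two-terms≤∑ f (suc i) (suc j) i≢j =
  ≤-trans (two-terms≤∑ (f ∘ suc) i j (i≢j ∘ cong suc)) (m≤n+m _ _)

∑-single : ∀ {k} (f : Fin k → ℕ) i → (∀ j → j ≢ i → f j ≡ 0) → sum f ≡ f i
∑-single {suc k} f zero f0 =
  trans (cong (f zero +_) (trans (sum-cong-≗ (λ j → f0 (suc j) λ ())) (sum-replicate-zero k)))
        (+-identityʳ _)
∑-single {suc k} f (suc i) f0 = trans (cong (_+ sum (f ∘ suc)) (f0 zero λ ()))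
                              (∑-single (f ∘ suc) i λ j j≢i → f0 (suc j) (j≢i ∘ fin-suc-injective))

∑-pos : ∀ {k} (f : Fin k → ℕ) → 1 ≤ sum f → Σ (Fin k) λ i → 1 ≤ f i
∑-pos {zero}  f ()
∑-pos {suc k} f pos with f zero in eq
... | suc _ = zero , subst (1 ≤_) (sym eq) (s≤s z≤n)
... | zero  = let (i , p) = ∑-pos (f ∘ suc) pos in suc i , p

∑-identity : ∀ {k} (f g h p q : Fin k → ℕ) → (∀ i → f i + g i + 2 * h i ≡ p i + q i) →
             sum f + sum g + 2 * sum h ≡ sum p + sum q
∑-identity f g h p q eq = begin
  sum f + sum g + 2 * sum h                 ≡⟨ cong₂ _+_ (∑-distrib-+ f g) (sym (*-distribˡ-sum 2 h)) ⟨
  sum (λ i → f i + g i) + sum (λ i → 2 * h i) ≡⟨ ∑-distrib-+ (λ i → f i + g i) (λ i → 2 * h i) ⟨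
  sum (λ i → f i + g i + 2 * h i)           ≡⟨ sum-cong-≗ eq ⟩
  sum (λ i → p i + q i)                     ≡⟨ ∑-distrib-+ p q ⟩
  sum p + sum q                             ∎
  where open ≡-Reasoning

∣∣≡∑ : ∀ {k} (p : Subset k) → ∣ p ∣ ≡ sum (𝟙 ∘ lookup p)
∣∣≡∑ []          = refl
∣∣≡∑ (true ∷ p)  = cong suc (∣∣≡∑ p)
∣∣≡∑ (false ∷ p) = ∣∣≡∑ p

list-sum≡∑ : ∀ {k l} (g : Fin k → Fin l) (f : Fin l → ℕ) →
             ListAction.sum (List.map f (List.tabulate g)) ≡ sum (f ∘ g)
list-sum≡∑ {zero}  g f = refl
list-sum≡∑ {suc k} g f = cong (f (g zero) +_) (list-sum≡∑ (g ∘ suc) f)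

¬-xor-¬ : ∀ x y → not x xor not y ≡ x xor y
¬-xor-¬ true  y = refl
¬-xor-¬ false y = not-involutive y

-- Edge-by-edge bookkeeping for two cuts A and C.  Let an edge have ends with
-- memberships (p, q) and (p′, q′) in (A, C).  It crosses A and C as often in
-- total as it crosses the corners A∖C and C∖A, plus twice if it joins the
-- corners A∩C and (co A)∩(co C) (first identity); likewise with the two
-- pairs of opposite corners exchanged (second identity).
corner-identity₁ : ∀ p q p′ q′ →
  𝟙 ((p ∧ not q) xor (p′ ∧ not q′)) + 𝟙 ((q ∧ not p) xor (q′ ∧ not p′)) +
  2 * 𝟙 (((p ∧ q) ∧ (not p′ ∧ not q′)) ∨ ((not p ∧ not q) ∧ (p′ ∧ q′)))
  ≡ 𝟙 (p xor p′) + 𝟙 (q xor q′)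
corner-identity₁ true  true  true  true  = refl
corner-identity₁ true  true  true  false = refl
corner-identity₁ true  true  false true  = refl
corner-identity₁ true  true  false false = refl
corner-identity₁ true  false true  true  = refl
corner-identity₁ true  false true  false = refl
corner-identity₁ true  false false true  = refl
corner-identity₁ true  false false false = refl
corner-identity₁ false true  true  true  = refl
corner-identity₁ false true  true  false = refl
corner-identity₁ false true  false true  = refl
corner-identity₁ false true  false false = refl
corner-identity₁ false false true  true  = refl
corner-identity₁ false false true  false = refl
corner-identity₁ false false false true  = refl
corner-identity₁ false false false false = refl

corner-identity₂ : ∀ p q p′ q′ →
  𝟙 ((p ∧ q) xor (p′ ∧ q′)) + 𝟙 ((not p ∧ not q) xor (not p′ ∧ not q′)) +
  2 * 𝟙 (((p ∧ not q) ∧ (q′ ∧ not p′)) ∨ ((q ∧ not p) ∧ (p′ ∧ not q′)))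
  ≡ 𝟙 (p xor p′) + 𝟙 (q xor q′)
corner-identity₂ true  true  true  true  = refl
corner-identity₂ true  true  true  false = refl
corner-identity₂ true  true  false true  = refl
corner-identity₂ true  true  false false = refl
corner-identity₂ true  false true  true  = refl
corner-identity₂ true  false true  false = refl
corner-identity₂ true  false false true  = refl
corner-identity₂ true  false false false = refl
corner-identity₂ false true  true  true  = refl
corner-identity₂ false true  true  false = refl
corner-identity₂ false true  false true  = refl
corner-identity₂ false true  false false = refl
corner-identity₂ false false true  true  = refl
corner-identity₂ false false true  false = refl
corner-identity₂ false false false true  = refl
corner-identity₂ false false false false = refl

split-count : ∀ x y → 𝟙 x ≡ 𝟙 (x ∧ y) + 𝟙 (x ∧ not y)
split-count true  true  = refl
split-count true  false = refl
split-count false y     = refl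

module VertexSets (G : Multigraph) where

  V : Set
  V = Fin (n G)

  E : Set
  E = Fin (m G)

  end₁ end₂ : E → V
  end₁ j = proj₁ (ends G j)
  end₂ j = proj₂ (ends G j)

  VSet : Set
  VSet = V → Bool

  co : VSet → VSet
  co X = not ∘ X

  inside : VSet → E → Bool
  inside X j = X (end₁ j) ∧ X (end₂ j)

  crosses : VSet → E → Bool
  crosses X j = X (end₁ j) xor X (end₂ j)

  size internal boundary : VSet → ℕ
  size X     = sum (𝟙 ∘ X)
  internal X = sum (𝟙 ∘ inside X)
  boundary X = sum (𝟙 ∘ crosses X)

  nonempty : ∀ {X} w → X w ≡ true → 1 ≤ size X
  nonempty {X} w w∈X = ≤-trans (≤-reflexive (cong 𝟙 (sym w∈X))) (term≤∑ (𝟙 ∘ X) w)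

  Cyclic : VSet → Set
  Cyclic X = HasCycleIn G (λ v → X v ≡ true)

  cyclic-mono : ∀ {P Q : V → Set} → (∀ v → P v → Q v) → HasCycleIn G P → HasCycleIn G Q
  cyclic-mono P⊆Q (C , inP) = C , (λ i → P⊆Q _ (inP i))

  _⊆ᵥ_ : VSet → VSet → Set
  X ⊆ᵥ Y = ∀ w → X w ≡ true → Y w ≡ true

  cyclic-⊆ : ∀ {X Y} → X ⊆ᵥ Y → Cyclic X → Cyclic Y
  cyclic-⊆ = cyclic-mono

  boundary-co : ∀ X → boundary (co X) ≡ boundary X
  boundary-co X = sum-cong-≗ λ j → cong 𝟙 (¬-xor-¬ (X (end₁ j)) (X (end₂ j)))

  ∣cut∣≡boundary : ∀ (A : Subset (n G)) → ∣ cut G A ∣ ≡ boundary (lookup A)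
  ∣cut∣≡boundary A = trans (∣∣≡∑ (cut G A)) (sum-cong-≗ λ j → cong 𝟙 (lookup∘tabulate (crosses (lookup A)) j))

  cut-cong : ∀ {A B : Subset (n G)} → (∀ w → lookup A w ≡ lookup B w) → cut G A ≡ cut G B
  cut-cong A≗B = tabulate-cong λ j → cong₂ _xor_ (A≗B (end₁ j)) (A≗B (end₂ j))

  cut-∁ : ∀ A → cut G (∁ A) ≡ cut G A
  cut-∁ A = tabulate-cong λ j →
    trans (cong₂ _xor_ (lookup-map (end₁ j) not A) (lookup-map (end₂ j) not A))
          (¬-xor-¬ (lookup A (end₁ j)) (lookup A (end₂ j)))

  cyclic-cut-sides : ∀ A → CyclicCut G A → Cyclic (lookup A) × Cyclic (co (lookup A))
  cyclic-cut-sides A (in-cyc , out-cyc) = cyclic-mono (λ w (w∈A : w ∈ A) → []=⇒lookup w∈A) in-cyc , cyclic-mono outside out-cyc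
    where
    outside : ∀ w → w ∉ A → not (lookup A w) ≡ true
    outside w w∉A with lookup A w in eq
    ... | true  = contradiction (lookup⇒[]= w A eq) w∉A
    ... | false = refl

  joins-inside : ∀ {X j x y} → Joins G j x y → X x ≡ true → X y ≡ true → inside X j ≡ true
  joins-inside (inj₁ refl) x∈X y∈X rewrite x∈X | y∈X = refl
  joins-inside (inj₂ refl) x∈X y∈X rewrite x∈X | y∈X = refl

  _∩_ _∖_ : VSet → VSet → VSet
  (X ∩ Y) v = X v ∧ Y v
  (X ∖ Y) v = X v ∧ not (Y v)

  between : VSet → VSet → E → Bool
  between X Y j = (X (end₁ j) ∧ Y (end₂ j)) ∨ (Y (end₁ j) ∧ X (end₂ j))

  edges-between : VSet → VSet → ℕ
  edges-between X Y = sum (𝟙 ∘ between X Y)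

  size-split : ∀ X Y → size X ≡ size (X ∩ Y) + size (X ∖ Y)
  size-split X Y = trans (sum-cong-≗ λ v → split-count (X v) (Y v)) (∑-distrib-+ (𝟙 ∘ (X ∩ Y)) (𝟙 ∘ (X ∖ Y)))

  corners-boundary₁ : ∀ A C →
    boundary (A ∖ C) + boundary (C ∖ A) + 2 * edges-between (A ∩ C) (co A ∩ co C) ≡ boundary A + boundary C
  corners-boundary₁ A C = ∑-identity _ _ _ _ _ λ j → corner-identity₁ (A (end₁ j)) (C (end₁ j)) (A (end₂ j)) (C (end₂ j))

  corners-boundary₂ : ∀ A C →
    boundary (A ∩ C) + boundary (co A ∩ co C) + 2 * edges-between (A ∖ C) (C ∖ A) ≡ boundary A + boundary C
  corners-boundary₂ A C = ∑-identity _ _ _ _ _ λ j → corner-identity₂ (A (end₁ j)) (C (end₁ j)) (A (end₂ j)) (C (end₂ j))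

module Handshake (G : Multigraph) where
  open VertexSets G

  δ : V → V → ℕ
  δ x v = 𝟙 (does (x ≟ v))

  δ-self : ∀ x → δ x x ≡ 1
  δ-self x with x ≟ x
  ... | yes _   = refl
  ... | no x≢x = contradiction refl x≢x

  δ-other : ∀ {x v} → x ≢ v → δ x v ≡ 0
  δ-other {x} {v} x≢v with x ≟ v
  ... | yes x≡v = contradiction x≡v x≢v
  ... | no _    = refl

  incid≡δ : ∀ v j → incid G v j ≡ δ (end₁ j) v + δ (end₂ j) v
  incid≡δ v j with does (end₁ j ≟ v) | does (end₂ j ≟ v)
  ... | true  | true  = refl
  ... | true  | false = refl
  ... | false | true  = refl
  ... | false | false = refl

  ∑-δ : ∀ (f : V → ℕ) x → sum (λ v → f v * δ x v) ≡ f x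
  ∑-δ f x = begin
    sum (λ v → f v * δ x v) ≡⟨ ∑-single _ x (λ v v≢x → trans (cong (f v *_) (δ-other (v≢x ∘ sym))) (*-zeroʳ (f v))) ⟩
    f x * δ x x             ≡⟨ cong (f x *_) (δ-self x) ⟩
    f x * 1                 ≡⟨ *-identityʳ (f x) ⟩
    f x                     ∎
    where open ≡-Reasoning

  ends-count : ∀ x y → 𝟙 x + 𝟙 y ≡ 2 * 𝟙 (x ∧ y) + 𝟙 (x xor y)
  ends-count true  true  = refl
  ends-count true  false = refl
  ends-count false true  = refl
  ends-count false false = refl

  ends-in : ∀ X j → sum (λ v → 𝟙 (X v) * incid G v j) ≡ 2 * 𝟙 (inside X j) + 𝟙 (crosses X j)
  ends-in X j = begin
    sum (λ v → 𝟙 (X v) * incid G v j)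
      ≡⟨ sum-cong-≗ (λ v → trans (cong (𝟙 (X v) *_) (incid≡δ v j)) (*-distribˡ-+ (𝟙 (X v)) _ _)) ⟩
    sum (λ v → 𝟙 (X v) * δ (end₁ j) v + 𝟙 (X v) * δ (end₂ j) v)
      ≡⟨ ∑-distrib-+ (λ v → 𝟙 (X v) * δ (end₁ j) v) (λ v → 𝟙 (X v) * δ (end₂ j) v) ⟩
    sum (λ v → 𝟙 (X v) * δ (end₁ j) v) + sum (λ v → 𝟙 (X v) * δ (end₂ j) v)
      ≡⟨ cong₂ _+_ (∑-δ (𝟙 ∘ X) (end₁ j)) (∑-δ (𝟙 ∘ X) (end₂ j)) ⟩
    𝟙 (X (end₁ j)) + 𝟙 (X (end₂ j))
      ≡⟨ ends-count (X (end₁ j)) (X (end₂ j)) ⟩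
    2 * 𝟙 (inside X j) + 𝟙 (crosses X j) ∎
    where open ≡-Reasoning

  degree≡∑ : ∀ v → degree G v ≡ sum (incid G v)
  degree≡∑ v = list-sum≡∑ (λ j → j) (incid G v)

  degree-sum : ∀ X → sum (λ v → 𝟙 (X v) * degree G v) ≡ 2 * internal X + boundary X
  degree-sum X = begin
    sum (λ v → 𝟙 (X v) * degree G v)
      ≡⟨ sum-cong-≗ (λ v → trans (cong (𝟙 (X v) *_) (degree≡∑ v)) (*-distribˡ-sum (𝟙 (X v)) (incid G v))) ⟩
    sum (λ v → sum (λ j → 𝟙 (X v) * incid G v j))
      ≡⟨ ∑-comm (λ v j → 𝟙 (X v) * incid G v j) ⟩
    sum (λ j → sum (λ v → 𝟙 (X v) * incid G v j))
      ≡⟨ sum-cong-≗ (ends-in X) ⟩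
    sum (λ j → 2 * 𝟙 (inside X j) + 𝟙 (crosses X j))
      ≡⟨ ∑-distrib-+ (λ j → 2 * 𝟙 (inside X j)) (𝟙 ∘ crosses X) ⟩
    sum (λ j → 2 * 𝟙 (inside X j)) + boundary X
      ≡⟨ cong (_+ boundary X) (*-distribˡ-sum 2 (𝟙 ∘ inside X)) ⟨
    2 * internal X + boundary X ∎
    where open ≡-Reasoning

  handshake : Cubic G → ∀ X → 3 * size X ≡ 2 * internal X + boundary X
  handshake cubic X = begin
    3 * size X                        ≡⟨ *-distribˡ-sum 3 (𝟙 ∘ X) ⟩
    sum (λ v → 3 * 𝟙 (X v))
      ≡⟨ sum-cong-≗ (λ v → trans (*-comm 3 (𝟙 (X v))) (cong (𝟙 (X v) *_) (sym (cubic v)))) ⟩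
    sum (λ v → 𝟙 (X v) * degree G v)  ≡⟨ degree-sum X ⟩
    2 * internal X + boundary X       ∎
    where open ≡-Reasoning

-- If every vertex of X has two edge-ends inside X, a path in X can be grown
-- at its start until the new edge returns to the path, closing a cycle;
-- otherwise a vertex with at most one internal edge-end can be deleted,
-- which keeps the inequality, and we recurse.
module DenseSets (G : Multigraph) where
  open VertexSets G
  open Handshake G using (δ; δ-self; δ-other)

  indeg : VSet → V → ℕ
  indeg X w = sum (λ j → 𝟙 (inside X j) * incid G w j)

  joins-sym : ∀ {f x y} → Joins G f x y → Joins G f y x
  joins-sym (inj₁ p) = inj₂ p
  joins-sym (inj₂ p) = inj₁ p

  end-of-joins : ∀ {f x y x′ y′} → Joins G f x y → Joins G f x′ y′ → x ≡ x′ ⊎ x ≡ y′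
  end-of-joins (inj₁ p) (inj₁ q) = inj₁ (cong proj₁ (trans (sym p) q))
  end-of-joins (inj₁ p) (inj₂ q) = inj₂ (cong proj₁ (trans (sym p) q))
  end-of-joins (inj₂ p) (inj₁ q) = inj₂ (cong proj₂ (trans (sym p) q))
  end-of-joins (inj₂ p) (inj₂ q) = inj₁ (cong proj₂ (trans (sym p) q))

  internal-neighbour : ∀ X w f → 1 ≤ 𝟙 (inside X f) * incid G w f →
                       Σ V λ z → Joins G f w z × X z ≡ true
  internal-neighbour X w f pos with X (end₁ f) in e₁ | X (end₂ f) in e₂ | end₁ f ≟ w | end₂ f ≟ w
  ... | true  | true  | yes refl | _        = end₂ f , inj₁ refl , e₂
  ... | true  | true  | no _     | yes refl = end₁ f , inj₂ refl , e₁
  ... | true  | true  | no _     | no _     = contradiction pos λ ()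
  ... | true  | false | _        | _        = contradiction pos λ ()
  ... | false | _     | _        | _        = contradiction pos λ ()

  loop-cycle : (j : E) → end₁ j ≡ end₂ j → Cycle G
  loop-cycle j loop = record
    { len = 0 ; vtx = λ _ → end₁ j ; edg = λ _ → j
    ; vtx-inj = λ { {zero} {zero} _ → refl }
    ; edg-inj = λ { {zero} {zero} _ → refl }
    ; joins = λ { zero → inj₁ (cong (end₁ j ,_) (sym loop)) } }

  record Path (X : VSet) : Set where
    field
      plen     : ℕ
      pvtx     : ℕ → V
      pedg     : ℕ → E
      pvtx-inj : ∀ i j → i ≤ plen → j ≤ plen → pvtx i ≡ pvtx j → i ≡ j
      pjoins   : ∀ i → i < plen → Joins G (pedg i) (pvtx i) (pvtx (suc i))
      pin      : ∀ i → i ≤ plen → X (pvtx i) ≡ true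
  open Path

  pedg-inj : ∀ {X} (p : Path X) i j → i < plen p → j < plen p → pedg p i ≡ pedg p j → i ≡ j
  pedg-inj p i j i<l j<l e with end-of-joins (pjoins p i i<l) (subst (λ f → Joins G f _ _) (sym e) (pjoins p j j<l))
                              | end-of-joins (joins-sym (pjoins p i i<l)) (subst (λ f → Joins G f _ _) (sym e) (pjoins p j j<l))
  ... | inj₁ vᵢ≡vⱼ | _ = pvtx-inj p i j (<⇒≤ i<l) (<⇒≤ j<l) vᵢ≡vⱼ
  ... | inj₂ _     | inj₂ vᵢ₊₁≡vⱼ₊₁ = suc-injective (pvtx-inj p (suc i) (suc j) i<l j<l vᵢ₊₁≡vⱼ₊₁)
  ... | inj₂ vᵢ≡vⱼ₊₁ | inj₁ vᵢ₊₁≡vⱼ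
      with pvtx-inj p i (suc j) (<⇒≤ i<l) j<l vᵢ≡vⱼ₊₁ | pvtx-inj p (suc i) j i<l (<⇒≤ j<l) vᵢ₊₁≡vⱼ
  ... | refl | i+2≡i = contradiction (sym i+2≡i) (<⇒≢ (m<n⇒m<1+n (n<1+n _)))

  module Closing {X : VSet} (p : Path X) (k : ℕ) (k≤len : k ≤ plen p) (f : E)
                 (f-joins : Joins G f (pvtx p k) (pvtx p 0))
                 (f-new : 0 < k → f ≢ pedg p 0) where

    cedg : ℕ → E
    cedg i with i <? k
    ... | yes _ = pedg p i
    ... | no _  = f

    path-edge≢f : ∀ i → i < k → pedg p i ≢ f
    path-edge≢f i i<k eᵢ≡f
      with end-of-joins (pjoins p i (≤-trans i<k k≤len)) (subst (λ g → Joins G g _ _) (sym eᵢ≡f) f-joins)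
    ... | inj₁ vᵢ≡vₖ = <-irrefl (pvtx-inj p i k (≤-trans (<⇒≤ i<k) k≤len) k≤len vᵢ≡vₖ) i<k
    ... | inj₂ vᵢ≡v₀ with pvtx-inj p i 0 (≤-trans (<⇒≤ i<k) k≤len) z≤n vᵢ≡v₀
    ...   | refl = f-new i<k (sym eᵢ≡f)

    -- (case analysis on i <? k also unfolds cedg in the hypothesis e)
    cedg-inj : ∀ i j → i ≤ k → j ≤ k → cedg i ≡ cedg j → i ≡ j
    cedg-inj i j i≤k j≤k e with i <? k | j <? k
    ... | yes i<k | yes j<k = pedg-inj p i j (≤-trans i<k k≤len) (≤-trans j<k k≤len) e
    ... | yes i<k | no _    = contradiction e (path-edge≢f i i<k)
    ... | no _    | yes j<k = contradiction (sym e) (path-edge≢f j j<k)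
    ... | no i≮k  | no j≮k  = trans (≤-antisym i≤k (≮⇒≥ i≮k)) (sym (≤-antisym j≤k (≮⇒≥ j≮k)))

    toℕ≤k : ∀ (i : Fin (suc k)) → toℕ i ≤ k
    toℕ≤k i = ≤-pred (toℕ<n i)

    toℕ-next : ∀ (i : Fin (suc k)) → toℕ (next i) ≡ suc (toℕ i) % suc k
    toℕ-next i = toℕ-fromℕ< _

    cjoins : ∀ i → Joins G (cedg (toℕ i)) (pvtx p (toℕ i)) (pvtx p (toℕ (next i)))
    cjoins i with toℕ i <? k
    ... | yes i<k = subst (λ w → Joins G (pedg p (toℕ i)) (pvtx p (toℕ i)) (pvtx p w))
                          (sym (trans (toℕ-next i) (m<n⇒m%n≡m (s≤s i<k))))
                          (pjoins p (toℕ i) (≤-trans i<k k≤len))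
    ... | no i≮k = subst₂ (λ x w → Joins G f (pvtx p x) (pvtx p w)) (sym i≡k)
                          (sym (trans (toℕ-next i) (trans (cong (λ x → suc x % suc k) i≡k) (n%n≡0 (suc k)))))
                          f-joins
      where
      i≡k : toℕ i ≡ k
      i≡k = ≤-antisym (toℕ≤k i) (≮⇒≥ i≮k)

    cycle : Cyclic X
    cycle = record
      { len = k
      ; vtx = λ i → pvtx p (toℕ i)
      ; edg = λ i → cedg (toℕ i)
      ; vtx-inj = λ {i} {j} e → toℕ-injective (pvtx-inj p _ _ (≤-trans (toℕ≤k i) k≤len) (≤-trans (toℕ≤k j) k≤len) e)
      ; edg-inj = λ {i} {j} e → toℕ-injective (cedg-inj _ _ (toℕ≤k i) (toℕ≤k j) e)
      ; joins = cjoins }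
      , λ i → pin p (toℕ i) (≤-trans (toℕ≤k i) k≤len)

  incid-of-joins : ∀ {g x y} → Joins G g x y → x ≢ y → incid G x g ≡ 1
  incid-of-joins {g} {x} {y} (inj₁ e) x≢y rewrite e with x ≟ x | y ≟ x
  ... | yes _ | no _    = refl
  ... | yes _ | yes y≡x = contradiction (sym y≡x) x≢y
  ... | no x≢x | _      = contradiction refl x≢x
  incid-of-joins {g} {x} {y} (inj₂ e) x≢y rewrite e with y ≟ x | x ≟ x
  ... | no _    | yes _ = refl
  ... | yes y≡x | _     = contradiction (sym y≡x) x≢y
  ... | no _    | no x≢x = contradiction refl x≢x

  -- If every vertex of X has two internal edge-ends, a path in X either
  -- closes into a cycle or extends by a new first vertex; since paths have
  -- at most |V| vertices, growing one from any vertex of X ends in a cycle.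
  module MinDegreeTwo (X : VSet) (deg≥2 : ∀ w → X w ≡ true → 2 ≤ indeg X w) where

    ends-at : V → E → ℕ
    ends-at w j = 𝟙 (inside X j) * incid G w j

    fresh-edge : (p : Path X) → Σ E λ f → 1 ≤ ends-at (pvtx p 0) f × (0 < plen p → f ≢ pedg p 0)
    fresh-edge p with any? (λ j → (¬? (j ≟ pedg p 0)) ×-dec (1 ≤? ends-at (pvtx p 0) j)) | 0 <? plen p
    ... | yes (f , f≢g , pos) | _ = f , pos , λ _ → f≢g
    ... | no _ | no len≡0 =
      let (f , pos) = ∑-pos (ends-at (pvtx p 0)) (≤-trans (s≤s z≤n) (deg≥2 _ (pin p 0 z≤n)))
      in f , pos , λ 0<len → contradiction 0<len len≡0
    ... | no only-g | yes 0<len = contradiction (deg≥2 w (pin p 0 z≤n)) (<⇒≱ (s≤s indeg≤1))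
      where
      w : V
      w = pvtx p 0
      g : E
      g = pedg p 0
      indeg≤1 : indeg X w ≤ 1
      indeg≤1 = begin
        indeg X w    ≡⟨ ∑-single (ends-at w) g (λ j j≢g → n<1⇒n≡0 (≰⇒> λ pos → only-g (j , j≢g , pos))) ⟩
        ends-at w g  ≤⟨ 𝟙*≤ (inside X g) (incid G w g) ⟩
        incid G w g  ≡⟨ incid-of-joins (pjoins p 0 0<len) (λ v₀≡v₁ → 0≢1+n (pvtx-inj p 0 1 z≤n 0<len v₀≡v₁)) ⟩
        1            ∎
        where open ≤-Reasoning

    prepend : (p : Path X) (z : V) (f : E) → (∀ i → i ≤ plen p → z ≢ pvtx p i) →
              Joins G f z (pvtx p 0) → X z ≡ true → Path X
    prepend p z f z∉p f-joins z∈X = record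
      { plen = suc (plen p) ; pvtx = vtx′ ; pedg = edg′
      ; pvtx-inj = inj′ ; pjoins = joins′ ; pin = in′ }
      where
      vtx′ : ℕ → V
      vtx′ zero    = z
      vtx′ (suc i) = pvtx p i
      edg′ : ℕ → E
      edg′ zero    = f
      edg′ (suc i) = pedg p i
      inj′ : ∀ i j → i ≤ suc (plen p) → j ≤ suc (plen p) → vtx′ i ≡ vtx′ j → i ≡ j
      inj′ zero    zero    _         _         _ = refl
      inj′ zero    (suc j) _         (s≤s j≤l) e = contradiction e (z∉p j j≤l)
      inj′ (suc i) zero    (s≤s i≤l) _         e = contradiction (sym e) (z∉p i i≤l)
      inj′ (suc i) (suc j) (s≤s i≤l) (s≤s j≤l) e = cong suc (pvtx-inj p i j i≤l j≤l e)
      joins′ : ∀ i → i < suc (plen p) → Joins G (edg′ i) (vtx′ i) (vtx′ (suc i))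
      joins′ zero    _         = f-joins
      joins′ (suc i) (s≤s i<l) = pjoins p i i<l
      in′ : ∀ i → i ≤ suc (plen p) → X (vtx′ i) ≡ true
      in′ zero    _         = z∈X
      in′ (suc i) (s≤s i≤l) = pin p i i≤l

    extend-or-close : (p : Path X) → Cyclic X ⊎ Σ (Path X) (λ p′ → plen p′ ≡ suc (plen p))
    extend-or-close p with fresh-edge p
    ... | f , pos , f-new with internal-neighbour X (pvtx p 0) f pos
    ... | z , f-joins , z∈X with any? (λ (i : Fin (suc (plen p))) → pvtx p (toℕ i) ≟ z)
    ... | yes (i , vᵢ≡z) = inj₁ (Closing.cycle p (toℕ i) i≤len f
                                   (joins-sym (subst (Joins G f _) (sym vᵢ≡z) f-joins))
                                   (λ 0<i → f-new (≤-trans 0<i i≤len)))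
      where
      i≤len : toℕ i ≤ plen p
      i≤len = ≤-pred (toℕ<n i)
    ... | no z∉p = inj₂ (prepend p z f z∉p′ (joins-sym f-joins) z∈X , refl)
      where
      z∉p′ : ∀ i → i ≤ plen p → z ≢ pvtx p i
      z∉p′ i i≤l z≡vᵢ = z∉p (fromℕ< (s≤s i≤l) , trans (cong (pvtx p) (toℕ-fromℕ< (s≤s i≤l))) (sym z≡vᵢ))

    -- a path has at most |V| vertices, so after r more steps a cycle appears
    grow : ∀ r (p : Path X) → n G ≤ plen p + r → Cyclic X
    grow zero p |V|≤len with pigeonhole (s≤s (≤-trans |V|≤len (≤-reflexive (+-identityʳ _))))
                                       (λ (i : Fin (suc (plen p))) → pvtx p (toℕ i))
    ... | i , j , i<j , vᵢ≡vⱼ = contradiction (pvtx-inj p _ _ (≤-pred (toℕ<n i)) (≤-pred (toℕ<n j)) vᵢ≡vⱼ) (<⇒≢ i<j)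
    grow (suc r) p |V|≤len+r with extend-or-close p
    ... | inj₁ cyc       = cyc
    ... | inj₂ (p′ , eq) = grow r p′ (≤-trans |V|≤len+r (≤-reflexive (trans (+-suc (plen p) r) (cong (_+ r) (sym eq)))))

    cycle-from : ∀ w → X w ≡ true → Cyclic X
    cycle-from w w∈X = grow (n G) trivial-path (m≤n+m (n G) 0)
      where
      trivial-path : Path X
      trivial-path = record
        { plen = 0 ; pvtx = λ _ → w ; pedg = λ _ → proj₁ (∑-pos (ends-at w) (≤-trans (s≤s z≤n) (deg≥2 w w∈X)))
        ; pvtx-inj = λ { _ _ z≤n z≤n _ → refl } ; pjoins = λ _ () ; pin = λ _ _ → w∈X }

  module DeleteVertex (X : VSet) (w : V) (w∈X : X w ≡ true) where

    X∖w : VSet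
    X∖w v = if does (v ≟ w) then false else X v

    X∖w⊆X : ∀ v → X∖w v ≡ true → X v ≡ true
    X∖w⊆X v v∈X∖w with v ≟ w
    ... | no _ = v∈X∖w

    size-delete : size X ≡ size X∖w + 1
    size-delete = begin
      size X                                     ≡⟨ sum-cong-≗ split ⟩
      sum (λ v → 𝟙 (X∖w v) + δ v w)              ≡⟨ ∑-distrib-+ (𝟙 ∘ X∖w) (λ v → δ v w) ⟩
      size X∖w + sum (λ v → δ v w)               ≡⟨ cong (size X∖w +_) (∑-single _ w (λ v → δ-other)) ⟩
      size X∖w + δ w w                           ≡⟨ cong (size X∖w +_) (δ-self w) ⟩
      size X∖w + 1                               ∎
      where
      open ≡-Reasoning
      split : ∀ v → 𝟙 (X v) ≡ 𝟙 (X∖w v) + δ v w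
      split v with v ≟ w
      ... | yes refl = cong 𝟙 w∈X
      ... | no _     = sym (+-identityʳ _)

    inside-delete : ∀ j → 𝟙 (inside X j) ≤ 𝟙 (inside X∖w j) + 𝟙 (inside X j) * incid G w j
    inside-delete j with end₁ j ≟ w | end₂ j ≟ w | X (end₁ j) | X (end₂ j)
    ... | _     | _     | false | _     = z≤n
    ... | _     | _     | true  | false = z≤n
    ... | yes _ | _     | true  | true  = s≤s z≤n
    ... | no _  | yes _ | true  | true  = s≤s z≤n
    ... | no _  | no _  | true  | true  = s≤s z≤n

    internal-delete : internal X ≤ internal X∖w + indeg X w
    internal-delete = begin
      internal X
        ≤⟨ ∑-mono inside-delete ⟩
      sum (λ j → 𝟙 (inside X∖w j) + 𝟙 (inside X j) * incid G w j)
        ≡⟨ ∑-distrib-+ (𝟙 ∘ inside X∖w) (λ j → 𝟙 (inside X j) * incid G w j) ⟩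
      internal X∖w + indeg X w ∎
      where open ≤-Reasoning

  -- Induction on |X| = s + 1: without a vertex of internal
  -- degree ≤ 1 use MinDegreeTwo; otherwise delete such a vertex if |X| ≥ 2,
  -- and if |X| = 1 the internal edge is a loop.
  dense⇒cyclic′ : ∀ s X → size X ≡ suc s → suc s ≤ internal X → Cyclic X
  dense⇒cyclic′ s X |X|≡1+s dense
    with any? (λ w → (X w Data.Bool.≟ true) ×-dec (indeg X w ≤? 1))
  ... | no no-low = MinDegreeTwo.cycle-from X (λ w w∈X → ≰⇒> λ low → no-low (w , w∈X , low))
                      (proj₁ some-w) (𝟙-pos (proj₂ some-w))
    where
    some-w : Σ V λ w → 1 ≤ 𝟙 (X w)
    some-w = ∑-pos (𝟙 ∘ X) (≤-trans (s≤s z≤n) (≤-reflexive (sym |X|≡1+s)))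
  ... | yes (w , w∈X , low) with s
  ...   | suc s′ = cyclic-mono X∖w⊆X (dense⇒cyclic′ s′ X∖w |X∖w| e≥)
    where
    open DeleteVertex X w w∈X
    |X∖w| : size X∖w ≡ suc s′
    |X∖w| = +-cancelʳ-≡ 1 _ _ (trans (sym size-delete) (trans |X|≡1+s (+-comm 1 (suc s′))))
    e≥ : suc s′ ≤ internal X∖w
    e≥ = +-cancelʳ-≤ 1 _ _ (≤-trans (≤-reflexive (+-comm (suc s′) 1))
                             (≤-trans dense (≤-trans internal-delete (+-monoʳ-≤ (internal X∖w) low))))
  ...   | zero with ∑-pos (𝟙 ∘ inside X) dense
  ...     | j , j-inside with X (end₁ j) in a∈X | X (end₂ j) in b∈X | end₁ j ≟ end₂ j
  ...       | true | true | yes loop = loop-cycle j loop , λ _ → a∈X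
  ...       | true | true | no a≢b   = contradiction (two-terms≤∑ (𝟙 ∘ X) _ _ a≢b) (<⇒≱ two>|X|)
    where
    two>|X| : size X < 𝟙 (X (end₁ j)) + 𝟙 (X (end₂ j))
    two>|X| rewrite a∈X | b∈X | |X|≡1+s = ≤-refl

  dense⇒cyclic : ∀ X → 1 ≤ size X → size X ≤ internal X → Cyclic X
  dense⇒cyclic X 1≤|X| dense with size X in eq
  ... | suc s = dense⇒cyclic′ s X eq dense

∤-consecutive : ∀ {s} → 2 ∣ s → 2 ∣ suc s → ⊥
∤-consecutive {s} 2∣s 2∣1+s = contradiction (∣1⇒≡1 (∣m+n∣m⇒∣n (subst (2 ∣_) (+-comm 1 s) 2∣1+s) 2∣s)) λ ()

sparse⇒boundary : ∀ c e d → 3 * c ≡ 2 * e + d → e < c → c + 2 ≤ d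
sparse⇒boundary c e d 3c≡2e+d e<c = +-cancelʳ-≤ (2 * c) (c + 2) d (begin
  c + 2 + 2 * c   ≡⟨ lhs c ⟩
  3 * c + 2       ≡⟨ cong (_+ 2) 3c≡2e+d ⟩
  2 * e + d + 2   ≡⟨ rhs e d ⟩
  2 * suc e + d   ≤⟨ +-monoˡ-≤ d (*-monoʳ-≤ 2 e<c) ⟩
  2 * c + d       ≡⟨ +-comm (2 * c) d ⟩
  d + 2 * c       ∎)
  where
  open ≤-Reasoning
  lhs : ∀ c → c + 2 + 2 * c ≡ 3 * c + 2
  lhs = solve-∀
  rhs : ∀ e d → 2 * e + d + 2 ≡ 2 * suc e + d
  rhs = solve-∀

-- case distinction on a number without abstracting it
zero-or-suc : ∀ k → k ≡ 0 ⊎ Σ ℕ λ l → k ≡ suc l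
zero-or-suc zero    = inj₁ refl
zero-or-suc (suc l) = inj₂ (l , refl)

module CyclicCuts (G : Multigraph) (cubic : Cubic G) (c4 : CyclicallyEdgeConnected 4 G) where
  open VertexSets G
  open Handshake G using (handshake)
  open DenseSets G using (dense⇒cyclic)

  cyclic⇒boundary≥4 : ∀ X → Cyclic X → Cyclic (co X) → 4 ≤ boundary X
  cyclic⇒boundary≥4 X X-cyc coX-cyc =
    ≤-trans (≮⇒≥ (c4 Y (cyclic-mono in-Y X-cyc , cyclic-mono out-Y coX-cyc)))
            (≤-reflexive (trans (∣cut∣≡boundary Y)
                                (sum-cong-≗ λ j → cong₂ (λ p q → 𝟙 (p xor q)) (lk (end₁ j)) (lk (end₂ j)))))
    where
    Y : Subset (n G)
    Y = tabulate X
    lk : ∀ v → lookup Y v ≡ X v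
    lk = lookup∘tabulate X
    in-Y : ∀ v → X v ≡ true → v ∈ Y
    in-Y v v∈X = lookup⇒[]= v Y (trans (lk v) v∈X)
    out-Y : ∀ v → not (X v) ≡ true → v ∉ Y
    out-Y v v∉X v∈Y = contradiction (subst (λ b → not b ≡ true) (trans (sym (lk v)) ([]=⇒lookup v∈Y)) v∉X) λ ()

  -- a nonempty set with cyclic complement has boundary ≥ min(4, |X| + 2):
  -- either it is dense, hence cyclic, or sparse, hence of large boundary
  boundary-bound : ∀ X → 1 ≤ size X → Cyclic (co X) → 4 ≤ boundary X ⊎ size X + 2 ≤ boundary X
  boundary-bound X nonempty coX-cyc with size X ≤? internal X
  ... | yes dense  = inj₁ (cyclic⇒boundary≥4 X (dense⇒cyclic X nonempty dense) coX-cyc)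
  ... | no ¬dense = inj₂ (sparse⇒boundary _ _ _ (handshake cubic X) (≰⇒> ¬dense))

  boundary≥3 : ∀ X → 1 ≤ size X → Cyclic (co X) → 3 ≤ boundary X
  boundary≥3 X nonempty coX-cyc with boundary-bound X nonempty coX-cyc
  ... | inj₁ d≥4   = ≤-trans (n≤1+n 3) d≥4
  ... | inj₂ d≥s+2 = ≤-trans (+-monoˡ-≤ 2 nonempty) d≥s+2

  boundary≥4 : ∀ X → 2 ≤ size X → Cyclic (co X) → 4 ≤ boundary X
  boundary≥4 X s≥2 coX-cyc with boundary-bound X (≤-trans (n≤1+n 1) s≥2) coX-cyc
  ... | inj₁ d≥4   = d≥4
  ... | inj₂ d≥s+2 = ≤-trans (+-monoˡ-≤ 2 s≥2) d≥s+2

  boundary≤3⇒single : ∀ X → 1 ≤ size X → Cyclic (co X) → boundary X ≤ 3 → size X ≡ 1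
  boundary≤3⇒single X nonempty coX-cyc d≤3 =
    ≤-antisym (≮⇒≥ λ s≥2 → <⇒≱ (s≤s d≤3) (boundary≥4 X s≥2 coX-cyc)) nonempty

  -- a 4-edge cut has sides of even size, as 3|X| = 2e(X) + 4
  size-even : ∀ X → boundary X ≡ 4 → 2 ∣ size X
  size-even X d≡4 = ∣m+n∣m⇒∣n 2∣2s+s (m∣m*n (size X))
    where
    2∣2s+s : 2 ∣ 2 * size X + size X
    2∣2s+s = subst (2 ∣_) (begin
      2 * (internal X + 2)   ≡⟨ *-distribˡ-+ 2 (internal X) 2 ⟩
      2 * internal X + 4     ≡⟨ cong (2 * internal X +_) d≡4 ⟨
      2 * internal X + boundary X ≡⟨ handshake cubic X ⟨
      size X + 2 * size X    ≡⟨ +-comm (size X) (2 * size X) ⟩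
      2 * size X + size X    ∎) (m∣m*n (internal X + 2))
      where open ≡-Reasoning

  -- a vertex with a loop, together with a cyclic complement, would give a
  -- cyclic cut with at most one edge
  no-loop-with-cyclic-rest : ∀ X (C : Cycle G) → len C ≡ 0 → (∀ i → X (vtx C i) ≡ true) → Cyclic (co X) → ⊥
  no-loop-with-cyclic-rest X C len≡0 C⊆X coX-cyc =
    contradiction (cyclic⇒boundary≥4 W (C , W-cycle) (cyclic-mono coX⊆coW coX-cyc))
                  (<⇒≱ (≤-<-trans d≤1 (s≤s (s≤s z≤n))))
    where
    open Handshake G using (δ-self; δ-other)
    w : V
    w = vtx C zero
    W : VSet
    W v = does (v ≟ w)
    W-w : W w ≡ true
    W-w = 𝟙-pos (≤-reflexive (sym (δ-self w)))
    only-w : ∀ i → vtx C i ≡ w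
    only-w i = cong (vtx C) (fin1 len≡0 i)
      where fin1 : ∀ {k} → k ≡ 0 → (i : Fin (suc k)) → i ≡ zero
            fin1 refl zero = refl
    W-cycle : ∀ i → W (vtx C i) ≡ true
    W-cycle i = subst (λ v → W v ≡ true) (sym (only-w i)) W-w
    coX⊆coW : ∀ v → not (X v) ≡ true → not (W v) ≡ true
    coX⊆coW v v∉X with v ≟ w
    ... | no _     = refl
    ... | yes refl = contradiction (trans (sym (cong not (C⊆X zero))) v∉X) λ ()
    |W|≡1 : size W ≡ 1
    |W|≡1 = trans (∑-single _ w λ v → δ-other) (δ-self w)
    loop-inside : 1 ≤ internal W
    loop-inside = ≤-trans (≤-reflexive (cong 𝟙 (sym (joins-inside {W} (joins C zero) (W-cycle zero) (W-cycle (next zero))))))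
                          (term≤∑ (𝟙 ∘ inside W) (edg C zero))
    d≤1 : boundary W ≤ 1
    d≤1 = +-cancelˡ-≤ 2 _ _ (begin
      2 + boundary W                 ≤⟨ +-monoˡ-≤ (boundary W) (*-monoʳ-≤ 2 loop-inside) ⟩
      2 * internal W + boundary W    ≡⟨ handshake cubic W ⟨
      3 * size W                     ≡⟨ cong (3 *_) |W|≡1 ⟩
      2 + 1                          ∎)
      where open ≤-Reasoning

  -- no cyclic 4-edge cut has a side with only two vertices: such a side has
  -- a single internal edge, too few for a cycle other than a loop
  no-cyclic-pair : ∀ X → size X ≡ 2 → boundary X ≡ 4 → Cyclic X → Cyclic (co X) → ⊥
  no-cyclic-pair X |X|≡2 d≡4 (C , C⊆X) coX-cyc with zero-or-suc (len C)
  ... | inj₁ len≡       = no-loop-with-cyclic-rest X C len≡ C⊆X coX-cyc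
  ... | inj₂ (l , len≡) =
    contradiction (≤-trans (≤-reflexive (cong₂ _+_ (cong 𝟙 (sym (inside-C i₀))) (cong 𝟙 (sym (inside-C i₁)))))
                           (two-terms≤∑ (𝟙 ∘ inside X) (edg C i₀) (edg C i₁) (i₀≢i₁ ∘ edg-inj C)))
                  (<⇒≱ (s≤s e≤1))
    where
    i₀ i₁ : Fin (suc (len C))
    i₀ = zero
    i₁ = subst (Fin ∘ suc) (sym len≡) (suc zero)
    i₀≢i₁ : i₀ ≢ i₁
    i₀≢i₁ = distinct (sym len≡)
      where distinct : ∀ {k l} (eq : suc l ≡ k) → zero ≢ subst (Fin ∘ suc) eq (suc zero)
            distinct refl ()
    inside-C : ∀ i → inside X (edg C i) ≡ true
    inside-C i = joins-inside {X} (joins C i) (C⊆X i) (C⊆X (next i))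
    e≤1 : internal X ≤ 1
    e≤1 = *-cancelˡ-≤ 2 (+-cancelʳ-≤ 4 _ _ (begin
      2 * internal X + 4            ≡⟨ cong (2 * internal X +_) d≡4 ⟨
      2 * internal X + boundary X   ≡⟨ handshake cubic X ⟨
      3 * size X                    ≡⟨ cong (3 *_) |X|≡2 ⟩
      2 * 1 + 4                     ∎))
      where open ≤-Reasoning

  cyclic-side≥3 : ∀ X → boundary X ≡ 4 → Cyclic X → Cyclic (co X) → 3 ≤ size X
  cyclic-side≥3 X d≡4 X-cyc@(C , C⊆X) coX-cyc with size X in |X|
  ... | zero = contradiction (subst (1 ≤_) |X| (nonempty (vtx C zero) (C⊆X zero))) λ ()
  ... | suc zero = ⊥-elim (∤-consecutive (m∣m*n 0) (subst (2 ∣_) |X| (size-even X d≡4)))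
  ... | suc (suc zero) = ⊥-elim (no-cyclic-pair X |X| d≡4 X-cyc coX-cyc)
  ... | suc (suc (suc s)) = s≤s (s≤s (s≤s z≤n))

  -- conversely a side of a 4-edge cut with at least three vertices, hence
  -- (being even) at least four, is dense and therefore cyclic
  side≥3-cyclic : ∀ X → boundary X ≡ 4 → 3 ≤ size X → Cyclic X
  side≥3-cyclic X d≡4 s≥3 = dense⇒cyclic X (≤-trans (s≤s z≤n) s≥3) (*-cancelˡ-≤ 2 (+-cancelʳ-≤ 4 _ _ (begin
    2 * size X + 4               ≤⟨ +-monoʳ-≤ (2 * size X) s≥4 ⟩
    2 * size X + size X          ≡⟨ +-comm (2 * size X) (size X) ⟩
    3 * size X                   ≡⟨ handshake cubic X ⟩
    2 * internal X + boundary X  ≡⟨ cong (2 * internal X +_) d≡4 ⟩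
    2 * internal X + 4           ∎)))
    where
    open ≤-Reasoning
    s≥4 : 4 ≤ size X
    s≥4 with m≤n⇒m<n∨m≡n s≥3
    ... | inj₁ s>3 = s>3
    ... | inj₂ s≡3 = ⊥-elim (∤-consecutive (m∣m*n 1) (subst (2 ∣_) (sym s≡3) (size-even X d≡4)))

module CutsThroughEdge (G : Multigraph) (cubic : Cubic G) (c4 : CyclicallyEdgeConnected 4 G) (e : Fin (m G)) where
  open VertexSets G
  open CyclicCuts G cubic c4

  u v : V
  u = end₁ e
  v = end₂ e

  Thick : VSet → Set
  Thick X = X u ≡ true × X v ≡ false × boundary X ≡ 4 × 3 ≤ size X × 3 ≤ size (co X)

  -- thickness is decidable, unlike the existence of cycles
  thick? : ∀ X → Dec (Thick X)
  thick? X = (X u Data.Bool.≟ true) ×-dec (X v Data.Bool.≟ false) ×-dec (boundary X Data.Nat.≟ 4)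
             ×-dec (3 ≤? size X) ×-dec (3 ≤? size (co X))

  co-co : ∀ {X} → Cyclic X → Cyclic (co (co X))
  co-co {X} = cyclic-mono λ w w∈X → trans (not-involutive (X w)) w∈X

  thick⇒cyclic : ∀ {X} → Thick X → Cyclic X × Cyclic (co X)
  thick⇒cyclic {X} (_ , _ , d≡4 , s≥3 , s′≥3) =
    side≥3-cyclic X d≡4 s≥3 , side≥3-cyclic (co X) (trans (boundary-co X) d≡4) s′≥3

  cyclic⇒thick : ∀ {X} → X u ≡ true → X v ≡ false → boundary X ≡ 4 → Cyclic X → Cyclic (co X) → Thick X
  cyclic⇒thick {X} u∈X v∉X d≡4 X-cyc coX-cyc =
    u∈X , v∉X , d≡4 , cyclic-side≥3 X d≡4 X-cyc coX-cyc ,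
    cyclic-side≥3 (co X) (trans (boundary-co X) d≡4) coX-cyc (co-co {X} X-cyc)

  -- Two thick sets A, C cannot cross, i.e. have all four corners nonempty:
  -- the corners A∖C and C∖A would be single vertices, so A∩C would be a
  -- side of a 4-edge cut with one vertex less than A, contradicting parity.
  module Crossing (A C : VSet) (A-thick : Thick A) (C-thick : Thick C)
                  (x : V) (x∈A∖C : (A ∖ C) x ≡ true) (y : V) (y∈C∖A : (C ∖ A) y ≡ true) where

    dA : boundary A ≡ 4
    dA = proj₁ (proj₂ (proj₂ A-thick))
    dC : boundary C ≡ 4
    dC = proj₁ (proj₂ (proj₂ C-thick))
    |A|≥3 : 3 ≤ size A
    |A|≥3 = proj₁ (proj₂ (proj₂ (proj₂ A-thick)))
    |coA|≥3 : 3 ≤ size (co A)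
    |coA|≥3 = proj₂ (proj₂ (proj₂ (proj₂ A-thick)))

    -- complements of the corners contain a cycle, as they contain C, A, co A, A
    C⊆co[A∖C] : C ⊆ᵥ co (A ∖ C)
    C⊆co[A∖C] w w∈C rewrite w∈C = cong not (∧-zeroʳ (A w))
    A⊆co[C∖A] : A ⊆ᵥ co (C ∖ A)
    A⊆co[C∖A] w w∈A rewrite w∈A = cong not (∧-zeroʳ (C w))
    coA⊆co[A∩C] : co A ⊆ᵥ co (A ∩ C)
    coA⊆co[A∩C] w w∉A with A w
    ... | false = refl
    A⊆co[coA∩coC] : A ⊆ᵥ co (co A ∩ co C)
    A⊆co[coA∩coC] w w∈A rewrite w∈A = refl

    co[A∖C]-cyclic : Cyclic (co (A ∖ C))
    co[A∖C]-cyclic = cyclic-⊆ C⊆co[A∖C] (proj₁ (thick⇒cyclic C-thick))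
    co[C∖A]-cyclic : Cyclic (co (C ∖ A))
    co[C∖A]-cyclic = cyclic-⊆ A⊆co[C∖A] (proj₁ (thick⇒cyclic A-thick))
    co[A∩C]-cyclic : Cyclic (co (A ∩ C))
    co[A∩C]-cyclic = cyclic-⊆ coA⊆co[A∩C] (proj₂ (thick⇒cyclic A-thick))
    co[coA∩coC]-cyclic : Cyclic (co (co A ∩ co C))
    co[coA∩coC]-cyclic = cyclic-⊆ A⊆co[coA∩coC] (proj₁ (thick⇒cyclic A-thick))

    e-between : 1 ≤ edges-between (A ∩ C) (co A ∩ co C)
    e-between = ≤-trans (≤-reflexive (cong 𝟙 (sym e-diag))) (term≤∑ _ e)
      where
      e-diag : between (A ∩ C) (co A ∩ co C) e ≡ true
      e-diag rewrite proj₁ A-thick | proj₁ C-thick | proj₁ (proj₂ A-thick) | proj₁ (proj₂ C-thick) = refl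

    d[A∖C]+d[C∖A]≤6 : boundary (A ∖ C) + boundary (C ∖ A) ≤ 6
    d[A∖C]+d[C∖A]≤6 = +-cancelʳ-≤ 2 _ _ (begin
      boundary (A ∖ C) + boundary (C ∖ A) + 2
        ≤⟨ +-monoʳ-≤ _ (*-monoʳ-≤ 2 e-between) ⟩
      boundary (A ∖ C) + boundary (C ∖ A) + 2 * edges-between (A ∩ C) (co A ∩ co C)
        ≡⟨ corners-boundary₁ A C ⟩
      boundary A + boundary C
        ≡⟨ cong₂ _+_ dA dC ⟩
      8 ∎)
      where open ≤-Reasoning

    d[A∩C]+d[coA∩coC]≤8 : boundary (A ∩ C) + boundary (co A ∩ co C) ≤ 8
    d[A∩C]+d[coA∩coC]≤8 = ≤-trans (m≤m+n _ _) (≤-reflexive (trans (corners-boundary₂ A C) (cong₂ _+_ dA dC)))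

    |A∖C|≡1 : size (A ∖ C) ≡ 1
    |A∖C|≡1 = boundary≤3⇒single (A ∖ C) (nonempty x x∈A∖C) co[A∖C]-cyclic
      (+-cancelʳ-≤ 3 _ _ (≤-trans (+-monoʳ-≤ _ (boundary≥3 (C ∖ A) (nonempty y y∈C∖A) co[C∖A]-cyclic))
                                  d[A∖C]+d[C∖A]≤6))
    |C∖A|≡1 : size (C ∖ A) ≡ 1
    |C∖A|≡1 = boundary≤3⇒single (C ∖ A) (nonempty y y∈C∖A) co[C∖A]-cyclic
      (+-cancelˡ-≤ 3 _ _ (≤-trans (+-monoˡ-≤ _ (boundary≥3 (A ∖ C) (nonempty x x∈A∖C) co[A∖C]-cyclic))
                                  d[A∖C]+d[C∖A]≤6))

    |A|≡1+|A∩C| : size A ≡ suc (size (A ∩ C))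
    |A|≡1+|A∩C| = trans (size-split A C) (trans (cong (size (A ∩ C) +_) |A∖C|≡1) (+-comm (size (A ∩ C)) 1))

    |coA|≡1+|coA∩coC| : size (co A) ≡ suc (size (co A ∩ co C))
    |coA|≡1+|coA∩coC| = trans (size-split (co A) C)
      (cong (_+ size (co A ∩ co C)) (trans (sum-cong-≗ λ w → cong 𝟙 (∧-comm (not (A w)) (C w))) |C∖A|≡1))

    -- the remaining corners have at least two vertices, so four boundary edges
    d[A∩C]≥4 : 4 ≤ boundary (A ∩ C)
    d[A∩C]≥4 = boundary≥4 (A ∩ C) (≤-pred (≤-trans |A|≥3 (≤-reflexive |A|≡1+|A∩C|)))
                          co[A∩C]-cyclic
    d[coA∩coC]≥4 : 4 ≤ boundary (co A ∩ co C)
    d[coA∩coC]≥4 = boundary≥4 (co A ∩ co C) (≤-pred (≤-trans |coA|≥3 (≤-reflexive |coA|≡1+|coA∩coC|)))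
                              co[coA∩coC]-cyclic

    d[A∩C]≡4 : boundary (A ∩ C) ≡ 4
    d[A∩C]≡4 = ≤-antisym (+-cancelʳ-≤ 4 _ _ (≤-trans (+-monoʳ-≤ _ d[coA∩coC]≥4) d[A∩C]+d[coA∩coC]≤8)) d[A∩C]≥4

    -- A and A∩C are sides of 4-edge cuts differing in one vertex
    impossible : ⊥
    impossible = ∤-consecutive (size-even (A ∩ C) d[A∩C]≡4) (subst (2 ∣_) |A|≡1+|A∩C| (size-even A dA))

  included-or-witness : ∀ A C → A ⊆ᵥ C ⊎ Σ V λ x → (A ∖ C) x ≡ true
  included-or-witness A C with any? (λ x → (A ∖ C) x Data.Bool.≟ true)
  ... | yes witness = inj₂ witness
  ... | no none     = inj₁ A⊆C
    where
    A⊆C : A ⊆ᵥ C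
    A⊆C x x∈A with C x in x∈C
    ... | true  = refl
    ... | false =
      contradiction (x , trans (cong (λ b → A x ∧ not b) x∈C) (trans (∧-identityʳ (A x)) x∈A)) none

  nested : ∀ {A C} → Thick A → Thick C → A ⊆ᵥ C ⊎ C ⊆ᵥ A
  nested {A} {C} A-thick C-thick with included-or-witness A C | included-or-witness C A
  ... | inj₁ A⊆C | _ = inj₁ A⊆C
  ... | inj₂ _ | inj₁ C⊆A = inj₂ C⊆A
  ... | inj₂ (x , x∈A∖C) | inj₂ (y , y∈C∖A) =
    ⊥-elim (Crossing.impossible A C A-thick C-thick x x∈A∖C y y∈C∖A)

  thick-cong : ∀ {X Y} → (∀ w → X w ≡ Y w) → Thick X → Thick Y
  thick-cong {X} {Y} X≗Y (u∈X , v∉X , d≡4 , s≥3 , s′≥3) =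
    trans (sym (X≗Y u)) u∈X , trans (sym (X≗Y v)) v∉X ,
    trans (sum-cong-≗ λ j → cong₂ (λ p q → 𝟙 (p xor q)) (sym (X≗Y (end₁ j))) (sym (X≗Y (end₂ j)))) d≡4 ,
    ≤-trans s≥3 (≤-reflexive (sum-cong-≗ (cong 𝟙 ∘ X≗Y))) ,
    ≤-trans s′≥3 (≤-reflexive (sum-cong-≗ (cong (𝟙 ∘ not) ∘ X≗Y)))

-- The chain: A_t is the union of the thick sets with at most t vertices.
-- Thick sets are nested, so a thick set A with |A| = t is exactly A_t.
module Chain (G : Multigraph) (cubic : Cubic G) (c4 : CyclicallyEdgeConnected 4 G) (e : Fin (m G)) where
  open VertexSets G
  open CutsThroughEdge G cubic c4 e

  Witness : ℕ → V → Subset (n G) → Set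
  Witness t x C = Thick (lookup C) × size (lookup C) ≤ t × lookup C x ≡ true

  witness? : ∀ t x → Dec (Σ (Subset (n G)) (Witness t x))
  witness? t x =
    anySubset? λ C → thick? (lookup C) ×-dec (size (lookup C) ≤? t) ×-dec (lookup C x Data.Bool.≟ true)

  chain : Fin (suc (n G)) → Subset (n G)
  chain t = tabulate λ x → does (witness? (toℕ t) x)

  chain-lookup : ∀ t x → lookup (chain t) x ≡ does (witness? (toℕ t) x)
  chain-lookup t x = lookup∘tabulate (λ x → does (witness? (toℕ t) x)) x

  witness-of : ∀ {P : Set} (d : Dec P) → does d ≡ true → P
  witness-of (yes p) _ = p

  chain-mono : ∀ i j → toℕ i ≤ toℕ j → chain i ⊆ chain j
  chain-mono i j i≤j {x} x∈chain-i
    with witness-of (witness? (toℕ i) x) (trans (sym (chain-lookup i x)) ([]=⇒lookup x∈chain-i))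
  ... | C , C-thick , |C|≤i , x∈C =
    lookup⇒[]= x (chain j)
      (trans (chain-lookup j x) (dec-true (witness? (toℕ j) x) (C , C-thick , ≤-trans |C|≤i i≤j , x∈C)))

  size-index : Subset (n G) → Fin (suc (n G))
  size-index A = fromℕ< (s≤s (∣p∣≤n A))

  toℕ-size-index : ∀ A → toℕ (size-index A) ≡ size (lookup A)
  toℕ-size-index A = trans (toℕ-fromℕ< (s≤s (∣p∣≤n A))) (∣∣≡∑ A)

  -- a thick set A with t vertices is the t-th member of the chain: every
  -- thick set with at most t vertices containing x is nested with A, and
  -- cannot strictly contain A
  chain-at-thick : ∀ A → Thick (lookup A) → ∀ x → lookup (chain (size-index A)) x ≡ lookup A x
  chain-at-thick A A-thick x with lookup A x in x∈?A
  ... | true  = trans (chain-lookup _ x)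
                      (dec-true (witness? _ x) (A , A-thick , ≤-reflexive (sym (toℕ-size-index A)) , x∈?A))
  ... | false = trans (chain-lookup _ x) (dec-false (witness? _ x) no-witness)
    where
    no-witness : ¬ Σ (Subset (n G)) (Witness (toℕ (size-index A)) x)
    no-witness (C , C-thick , |C|≤|A| , x∈C) with nested C-thick A-thick
    ... | inj₁ C⊆A = contradiction (trans (sym (C⊆A x x∈C)) x∈?A) λ ()
    ... | inj₂ A⊆C = <⇒≱ (∑-strict A≤C x A<C) (≤-trans |C|≤|A| (≤-reflexive (toℕ-size-index A)))
      where
      A≤C : ∀ w → 𝟙 (lookup A w) ≤ 𝟙 (lookup C w)
      A≤C w with lookup A w in w∈A
      ... | true  = ≤-reflexive (cong 𝟙 (sym (A⊆C w w∈A)))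
      ... | false = z≤n
      A<C : 𝟙 (lookup A x) < 𝟙 (lookup C x)
      A<C rewrite x∈?A | x∈C = s≤s z≤n

  oriented : ∀ A → boundary (lookup A) ≡ 4 → Cyclic (lookup A) → Cyclic (co (lookup A)) →
             lookup A u xor lookup A v ≡ true →
             Σ (Subset (n G)) λ A′ → Thick (lookup A′) × cut G A′ ≡ cut G A
  oriented A d≡4 A-cyc coA-cyc u-v-split with lookup A u in u∈?A | lookup A v in v∈?A
  ... | true  | false = A , cyclic⇒thick u∈?A v∈?A d≡4 A-cyc coA-cyc , refl
  ... | false | true  =
    ∁ A , thick-cong (λ w → sym (lookup-map w not A))
                     (cyclic⇒thick (cong not u∈?A) (cong not v∈?A) (trans (boundary-co (lookup A)) d≡4)
                                   coA-cyc (co-co {lookup A} A-cyc)) ,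
    cut-∁ A
  ... | true  | true  = contradiction u-v-split λ ()
  ... | false | false = contradiction u-v-split λ ()

  thick-side : ∀ A → CyclicCut G A → ∣ cut G A ∣ ≡ 4 → e ∈ cut G A →
               Σ (Subset (n G)) λ A′ → Thick (lookup A′) × cut G A′ ≡ cut G A
  thick-side A A-cyclic |cut|≡4 e∈cut =
    oriented A (trans (sym (∣cut∣≡boundary A)) |cut|≡4)
             (proj₁ (cyclic-cut-sides A A-cyclic)) (proj₂ (cyclic-cut-sides A A-cyclic))
             (trans (sym (lookup∘tabulate (crosses (lookup A)) e)) ([]=⇒lookup e∈cut))

lemma24 : (G : Multigraph) → Cubic G → CyclicallyEdgeConnected 4 G →
          (e : Fin (m G)) →
          (Σ (Subset (n G)) λ A → CyclicCut G A × ∣ cut G A ∣ ≡ 4 × e ∈ cut G A) →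
          Σ ℕ λ k → Σ (Fin k → Subset (n G)) λ As →
            (∀ i j → toℕ i ≤ toℕ j → As i ⊆ As j) ×
            (∀ (A : Subset (n G)) → CyclicCut G A → ∣ cut G A ∣ ≡ 4 → e ∈ cut G A →
              Σ (Fin k) λ i → cut G A ≡ cut G (As i))
lemma24 G cubic c4 e _ = suc (n G) , chain , chain-mono , covers
  where
  open VertexSets G using (cut-cong)
  open Chain G cubic c4 e
  covers : ∀ (A : Subset (n G)) → CyclicCut G A → ∣ cut G A ∣ ≡ 4 → e ∈ cut G A →
           Σ (Fin (suc (n G))) λ i → cut G A ≡ cut G (chain i)
  covers A A-cyclic |cut|≡4 e∈cut with thick-side A A-cyclic |cut|≡4 e∈cut
  ... | A′ , A′-thick , cut-A′≡cut-A =
    size-index A′ ,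
    trans (sym cut-A′≡cut-A) (cut-cong {A′} {chain (size-index A′)} (λ x → sym (chain-at-thick A′ A′-thick x)))
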